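{- Let $E$ be a finite set and let $\lambda:2^E\to\mathbb{R}$ be a connectivity function on $E$. Then there exists a compact, self-dual polymatroid $P=(r,E)$ whose connectivity function $\lambda_P$ equals $\lambda$.
   Context: A connectivity function on a finite set $E$ is a function $\lambda:2^E\to\mathbb{R}$ with $\lambda(\emptyset)=0$, $\lambda(X)=\lambda(E-X)$ for all $X\subseteq E$, and $\lambda(X\cap Y)+\lambda(X\cup Y)\le\lambda(X)+\lambda(Y)$ for all $X,Y\subseteq E$. A polymatroid $P=(r,E)$ is a finite set $E$ with a function $r:2^E\to\mathbb{R}$ such that $r(\emptyset)=0$, $r(X\cap Y)+r(X\cup Y)\le r(X)+r(Y)$ for all $X,Y\subseteq E$, and $r(X)\le r(Y)$ whenever $X\subseteq Y\subseteq E$. Its connectivity function is $\lambda_P(X)=r(X)+r(E-X)-r(E)$. For $X\subseteq E$ let $\|X\|_r=\sum_{x\in X}r(\{x\})$. The dual of $P$ is $P^*=(r^*,E)$ where $r^*(X)=r(E-X)+\|X\|_r-r(E)$ for all $X\subseteq E$; $P$ is self-dual if $r^*=r$. An element $e\in E$ is compact if $r(\{e\})=\lambda_P(\{e\})$, and $P$ is compact if every element of $E$ is compact. -}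

module Defs where

open import Level using (Level; _⊔_) renaming (suc to lsuc)
open import Data.Nat using (ℕ; zero; suc)
open import Data.Fin using (Fin)
open import Data.Bool using (if_then_else_)
open import Data.Fin.Subset using (Subset; _∩_; _∪_; ∁; ⊥; ⊤; ⁅_⁆; _⊆_)
open import Data.Vec using (lookup)
open import Data.Product using (∃)
open import Relation.Nullary using (¬_)
open import Relation.Binary.Structures using (IsTotalOrder)
open import Algebra.Bundles using (CommutativeRing)

-- An ordered field (the reals ℝ are the intended instance; agda-stdlib has no ℝ).
record OrderedField (c ℓ₁ ℓ₂ : Level) : Set (lsuc (c ⊔ ℓ₁ ⊔ ℓ₂)) where
  field
    commRing : CommutativeRing c ℓ₁
  open CommutativeRing commRing public
  field
    _≤_           : Carrier → Carrier → Set ℓ₂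
    isTotalOrder  : IsTotalOrder _≈_ _≤_
    +-mono-≤      : ∀ {x y} z → x ≤ y → (x + z) ≤ (y + z)
    *-nonneg      : ∀ {x y} → 0# ≤ x → 0# ≤ y → 0# ≤ (x * y)
    0≉1           : ¬ (0# ≈ 1#)
    inverse       : ∀ x → ¬ (x ≈ 0#) → ∃ λ y → (x * y) ≈ 1#

module _ {c ℓ₁ ℓ₂ : Level} (F : OrderedField c ℓ₁ ℓ₂) where
  open OrderedField F

  sumFin : ∀ n → (Fin n → Carrier) → Carrier
  sumFin zero    f = 0#
  sumFin (suc n) f = f Fin.zero + sumFin n (λ i → f (Fin.suc i))

  record IsConnectivityFunction {n : ℕ} (κ : Subset n → Carrier) : Set (c ⊔ ℓ₁ ⊔ ℓ₂) where
    field
      empty     : κ ⊥ ≈ 0#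
      symmetric : ∀ X → κ X ≈ κ (∁ X)
      submod    : ∀ X Y → (κ (X ∩ Y) + κ (X ∪ Y)) ≤ (κ X + κ Y)

  record IsPolymatroid {n : ℕ} (r : Subset n → Carrier) : Set (c ⊔ ℓ₁ ⊔ ℓ₂) where
    field
      empty    : r ⊥ ≈ 0#
      submod   : ∀ X Y → (r (X ∩ Y) + r (X ∪ Y)) ≤ (r X + r Y)
      monotone : ∀ X Y → X ⊆ Y → r X ≤ r Y

  connectivity : ∀ {n} → (Subset n → Carrier) → Subset n → Carrier
  connectivity r X = r X + r (∁ X) - r ⊤

  norm : ∀ {n} → (Subset n → Carrier) → Subset n → Carrier
  norm {n} r X = sumFin n (λ x → if lookup X x then r ⁅ x ⁆ else 0#)

  dual : ∀ {n} → (Subset n → Carrier) → Subset n → Carrier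
  dual r X = r (∁ X) + norm r X - r ⊤

  SelfDual : ∀ {n} → (Subset n → Carrier) → Set ℓ₁
  SelfDual r = ∀ X → dual r X ≈ r X

  Compact : ∀ {n} → (Subset n → Carrier) → Set ℓ₁
  Compact {n} r = (e : Fin n) → r ⁅ e ⁆ ≈ connectivity r ⁅ e ⁆

-- Take r = (λ + ‖·‖_λ)/2, where ‖X‖_λ = Σ_{x ∈ X} λ({x}). Since λ(E) = 0 and ‖·‖_λ is modular,
-- r(X) + r(E - X) = λ(X) + r(E), which gives λ_r = λ and, as r({e}) = λ({e}), also r* = r and
-- compactness. Submodularity of r is inherited from λ. Monotonicity is the one real inequality:
-- for X ⊆ Y, submodularity of λ at E - Y and Y - X together with symmetry gives
-- λ(X) ≤ λ(Y) + λ(Y - X), and λ(Y - X) ≤ ‖Y - X‖_λ because a normalised submodular function is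
-- subadditive.
module Submission where

open import Defs
open import Level using (Level)
open import Data.Nat using (ℕ; zero; suc)
open import Data.Fin using (Fin)
open import Data.Bool using (Bool; true; false; not; _∧_; _∨_; if_then_else_)
open import Data.Vec using ([]; _∷_; lookup; here)
open import Data.Vec.Properties using (lookup-zipWith; lookup-map; lookup-replicate; map-replicate)
open import Data.Fin.Subset using (Subset; _∩_; _∪_; _─_; ∁; ⊥; ⊤; ⁅_⁆; _⊆_; inside; outside)
open import Data.Fin.Subset.Properties using (drop-∷-⊆; p⊆q⇒∁p⊇∁q; ∩-zeroˡ; ∪-identityˡ)
open import Data.Product using (∃; _×_; _,_; proj₁; proj₂)
open import Data.Sum using (inj₁; inj₂)
open import Relation.Nullary using (¬_; contradiction)
open import Relation.Binary.PropositionalEquality as ≡ using (_≡_; cong)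
open import Relation.Binary.Bundles using (Poset)
open import Relation.Binary.Structures using (IsTotalOrder)
import Relation.Binary.Reasoning.PartialOrder as PartialOrderReasoning
import Relation.Binary.Reasoning.Setoid as SetoidReasoning

p∩[q─p]≡⊥ : ∀ {n} (p q : Subset n) → p ∩ (q ─ p) ≡ ⊥
p∩[q─p]≡⊥ []            []      = ≡.refl
p∩[q─p]≡⊥ (inside  ∷ p) (_ ∷ q) = cong (outside ∷_) (p∩[q─p]≡⊥ p q)
p∩[q─p]≡⊥ (outside ∷ p) (_ ∷ q) = cong (outside ∷_) (p∩[q─p]≡⊥ p q)

p⊆q⇒p∪[q─p]≡q : ∀ {n} {p q : Subset n} → p ⊆ q → p ∪ (q ─ p) ≡ q
p⊆q⇒p∪[q─p]≡q {p = []}          {[]}          _   = ≡.refl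
p⊆q⇒p∪[q─p]≡q {p = inside  ∷ p} {inside  ∷ q} p⊆q = cong (inside ∷_) (p⊆q⇒p∪[q─p]≡q (drop-∷-⊆ p⊆q))
p⊆q⇒p∪[q─p]≡q {p = inside  ∷ p} {outside ∷ q} p⊆q = contradiction (p⊆q here) λ ()
p⊆q⇒p∪[q─p]≡q {p = outside ∷ p} {s       ∷ q} p⊆q = cong (s ∷_) (p⊆q⇒p∪[q─p]≡q (drop-∷-⊆ p⊆q))

∁p─∁q≡q─p : ∀ {n} (p q : Subset n) → ∁ p ─ ∁ q ≡ q ─ p
∁p─∁q≡q─p []            []            = ≡.refl
∁p─∁q≡q─p (inside  ∷ p) (inside  ∷ q) = cong (outside ∷_) (∁p─∁q≡q─p p q)
∁p─∁q≡q─p (inside  ∷ p) (outside ∷ q) = cong (outside ∷_) (∁p─∁q≡q─p p q)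
∁p─∁q≡q─p (outside ∷ p) (inside  ∷ q) = cong (inside ∷_) (∁p─∁q≡q─p p q)
∁p─∁q≡q─p (outside ∷ p) (outside ∷ q) = cong (outside ∷_) (∁p─∁q≡q─p p q)

∁⊥≡⊤ : ∀ {n} → ∁ (⊥ {n}) ≡ ⊤
∁⊥≡⊤ {n} = map-replicate not false n

module _ {c ℓ₁ ℓ₂ : Level} (F : OrderedField c ℓ₁ ℓ₂) where
  open OrderedField F
  open IsTotalOrder isTotalOrder using (total; antisym; isPartialOrder) renaming (reflexive to ≤-reflexive)
  open import Algebra.Properties.Ring ring using (-1*x≈-x; -‿involutive; -‿distribˡ-*)
  open import Algebra.Solver.Ring.NaturalCoefficients.Default commutativeSemiring
    using (solve; _:+_; _:*_; _:=_)

  ≤-poset : Poset c ℓ₁ ℓ₂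
  ≤-poset = record { isPartialOrder = isPartialOrder }

  module ≤-Reasoning = PartialOrderReasoning ≤-poset
  module ≈-Reasoning = SetoidReasoning setoid

  [x+y]-y≈x : ∀ x y → (x + y) - y ≈ x
  [x+y]-y≈x x y = trans (+-assoc x y (- y)) (trans (+-congˡ (-‿inverseʳ y)) (+-identityʳ x))

  [x-y]+y≈x : ∀ x y → (x - y) + y ≈ x
  [x-y]+y≈x x y = trans (+-assoc x (- y) y) (trans (+-congˡ (-‿inverseˡ y)) (+-identityʳ x))

  x≈y+z⇒x-z≈y : ∀ {x y z} → x ≈ y + z → x - z ≈ y
  x≈y+z⇒x-z≈y {x} {y} {z} x≈y+z = trans (+-congʳ x≈y+z) ([x+y]-y≈x y z)

  +-monoʳ-≤ : ∀ z {x y} → x ≤ y → (z + x) ≤ (z + y)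
  +-monoʳ-≤ z {x} {y} x≤y = begin
    z + x ≈⟨ +-comm z x ⟩
    x + z ≤⟨ +-mono-≤ z x≤y ⟩
    y + z ≈⟨ +-comm y z ⟩
    z + y ∎
    where open ≤-Reasoning

  +-mono₂-≤ : ∀ {x y u v} → x ≤ y → u ≤ v → (x + u) ≤ (y + v)
  +-mono₂-≤ {x} {y} {u} {v} x≤y u≤v = begin
    x + u ≤⟨ +-mono-≤ u x≤y ⟩
    y + u ≤⟨ +-monoʳ-≤ y u≤v ⟩
    y + v ∎
    where open ≤-Reasoning

  x≤0⇒0≤-x : ∀ {x} → x ≤ 0# → 0# ≤ (- x)
  x≤0⇒0≤-x {x} x≤0 = begin
    0#      ≈⟨ sym (-‿inverseʳ x) ⟩
    x - x   ≤⟨ +-mono-≤ (- x) x≤0 ⟩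
    0# - x  ≈⟨ +-identityˡ (- x) ⟩
    - x     ∎
    where open ≤-Reasoning

  0≤-x⇒x≤0 : ∀ {x} → 0# ≤ (- x) → x ≤ 0#
  0≤-x⇒x≤0 {x} 0≤-x = begin
    x         ≈⟨ sym (+-identityˡ x) ⟩
    0# + x    ≤⟨ +-mono-≤ x 0≤-x ⟩
    - x + x   ≈⟨ -‿inverseˡ x ⟩
    0#        ∎
    where open ≤-Reasoning

  x≤y⇒0≤y-x : ∀ {x y} → x ≤ y → 0# ≤ (y - x)
  x≤y⇒0≤y-x {x} {y} x≤y = begin
    0#     ≈⟨ sym (-‿inverseʳ x) ⟩
    x - x  ≤⟨ +-mono-≤ (- x) x≤y ⟩
    y - x  ∎
    where open ≤-Reasoning

  *-monoʳ-≤-nonNeg : ∀ {z x y} → 0# ≤ z → x ≤ y → (z * x) ≤ (z * y)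
  *-monoʳ-≤-nonNeg {z} {x} {y} 0≤z x≤y = begin
    z * x                  ≈⟨ sym (+-identityˡ (z * x)) ⟩
    0# + z * x             ≤⟨ +-mono-≤ (z * x) (*-nonneg 0≤z (x≤y⇒0≤y-x x≤y)) ⟩
    z * (y - x) + z * x    ≈⟨ sym (distribˡ z (y - x) x) ⟩
    z * ((y - x) + x)      ≈⟨ *-congˡ ([x-y]+y≈x y x) ⟩
    z * y                  ∎
    where open ≤-Reasoning

  0≤1 : 0# ≤ 1#
  0≤1 with total 0# 1#
  ... | inj₁ 0≤1 = 0≤1
  ... | inj₂ 1≤0 = begin
    0#              ≤⟨ *-nonneg 0≤-1 0≤-1 ⟩
    - 1# * - 1#     ≈⟨ -1*x≈-x (- 1#) ⟩
    - - 1#          ≈⟨ -‿involutive 1# ⟩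
    1#              ∎
    where
    open ≤-Reasoning
    0≤-1 : 0# ≤ (- 1#)
    0≤-1 = x≤0⇒0≤-x 1≤0

  1≰0 : ¬ (1# ≤ 0#)
  1≰0 1≤0 = 0≉1 (antisym 0≤1 1≤0)

  x*y≈1∧0≤y⇒0≤x : ∀ {x y} → x * y ≈ 1# → 0# ≤ y → 0# ≤ x
  x*y≈1∧0≤y⇒0≤x {x} {y} xy≈1 0≤y with total 0# x
  ... | inj₁ 0≤x = 0≤x
  ... | inj₂ x≤0 = contradiction (0≤-x⇒x≤0 0≤-1) 1≰0
    where
    open ≤-Reasoning
    0≤-1 : 0# ≤ (- 1#)
    0≤-1 = begin
      0#         ≤⟨ *-nonneg (x≤0⇒0≤-x x≤0) 0≤y ⟩
      - x * y    ≈⟨ sym (-‿distribˡ-* x y) ⟩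
      - (x * y)  ≈⟨ -‿cong xy≈1 ⟩
      - 1#       ∎

  2# : Carrier
  2# = 1# + 1#

  0≤2 : 0# ≤ 2#
  0≤2 = begin
    0#       ≈⟨ +-identityˡ 0# ⟨
    0# + 0#  ≤⟨ +-mono₂-≤ 0≤1 0≤1 ⟩
    2#       ∎
    where open ≤-Reasoning

  2≉0 : ¬ (2# ≈ 0#)
  2≉0 2≈0 = 1≰0 (begin
    1#        ≈⟨ sym (+-identityˡ 1#) ⟩
    0# + 1#   ≤⟨ +-mono-≤ 1# 0≤1 ⟩
    2#        ≈⟨ 2≈0 ⟩
    0#        ∎)
    where open ≤-Reasoning

  ½ : Carrier
  ½ = proj₁ (inverse 2# 2≉0)

  ½*2≈1 : ½ * 2# ≈ 1#
  ½*2≈1 = trans (*-comm ½ 2#) (proj₂ (inverse 2# 2≉0))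

  0≤½ : 0# ≤ ½
  0≤½ = x*y≈1∧0≤y⇒0≤x ½*2≈1 0≤2

  ½*[x+x]≈x : ∀ x → ½ * (x + x) ≈ x
  ½*[x+x]≈x x = begin
    ½ * (x + x)           ≈⟨ *-congˡ (+-cong (*-identityˡ x) (*-identityˡ x)) ⟨
    ½ * (1# * x + 1# * x) ≈⟨ *-congˡ (distribʳ x 1# 1#) ⟨
    ½ * (2# * x)          ≈⟨ *-assoc ½ 2# x ⟨
    (½ * 2#) * x          ≈⟨ *-congʳ ½*2≈1 ⟩
    1# * x                ≈⟨ *-identityˡ x ⟩
    x                     ∎
    where open ≈-Reasoning

  sumFin-cong : ∀ n {f g : Fin n → Carrier} → (∀ i → f i ≈ g i) → sumFin F n f ≈ sumFin F n g
  sumFin-cong zero    f≈g = refl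
  sumFin-cong (suc n) f≈g = +-cong (f≈g Fin.zero) (sumFin-cong n (λ i → f≈g (Fin.suc i)))

  sumFin-+ : ∀ n (f g : Fin n → Carrier) →
             sumFin F n (λ i → f i + g i) ≈ sumFin F n f + sumFin F n g
  sumFin-+ zero    f g = sym (+-identityˡ 0#)
  sumFin-+ (suc n) f g = trans (+-congˡ (sumFin-+ n _ _))
    (solve 4 (λ a b c d → (a :+ b) :+ (c :+ d) := (a :+ c) :+ (b :+ d)) refl
       (f Fin.zero) (g Fin.zero) _ _)

  sumFin-0 : ∀ n (f : Fin n → Carrier) → (∀ i → f i ≈ 0#) → sumFin F n f ≈ 0#
  sumFin-0 zero    f f≈0 = refl
  sumFin-0 (suc n) f f≈0 =
    trans (+-cong (f≈0 Fin.zero) (sumFin-0 n _ (λ i → f≈0 (Fin.suc i)))) (+-identityˡ 0#)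

  -- `norm F f` is definitionally `weight (λ x → f ⁅ x ⁆)`.
  weight : ∀ {n} → (Fin n → Carrier) → Subset n → Carrier
  weight {n} w X = sumFin F n (λ x → if lookup X x then w x else 0#)

  private
    ite : Bool → Carrier → Carrier
    ite b v = if b then v else 0#

    ite-∧-∨ : ∀ a b v → ite (a ∧ b) v + ite (a ∨ b) v ≈ ite a v + ite b v
    ite-∧-∨ true  true  v = refl
    ite-∧-∨ true  false v = +-comm 0# v
    ite-∧-∨ false true  v = refl
    ite-∧-∨ false false v = refl

    ite-not : ∀ a v → ite a v + ite (not a) v ≈ v
    ite-not true  v = +-identityʳ v
    ite-not false v = +-identityˡ v

  weight-∩-∪ : ∀ {n} (w : Fin n → Carrier) X Y →
               weight w (X ∩ Y) + weight w (X ∪ Y) ≈ weight w X + weight w Y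
  weight-∩-∪ {n} w X Y = trans (sym (sumFin-+ n _ _)) (trans (sumFin-cong n pointwise) (sumFin-+ n _ _))
    where
    pointwise : ∀ i → ite (lookup (X ∩ Y) i) (w i) + ite (lookup (X ∪ Y) i) (w i)
                      ≈ ite (lookup X i) (w i) + ite (lookup Y i) (w i)
    pointwise i rewrite lookup-zipWith _∧_ i X Y | lookup-zipWith _∨_ i X Y =
      ite-∧-∨ (lookup X i) (lookup Y i) (w i)

  weight-∁ : ∀ {n} (w : Fin n → Carrier) X → weight w X + weight w (∁ X) ≈ weight w ⊤
  weight-∁ {n} w X = trans (sym (sumFin-+ n _ _)) (sumFin-cong n pointwise)
    where
    pointwise : ∀ i → ite (lookup X i) (w i) + ite (lookup (∁ X) i) (w i) ≈ ite (lookup (⊤ {n}) i) (w i)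
    pointwise i rewrite lookup-map i not X | lookup-replicate i true = ite-not (lookup X i) (w i)

  weight-⊥ : ∀ {n} (w : Fin n → Carrier) → weight w ⊥ ≈ 0#
  weight-⊥ {n} w = sumFin-0 n _ pointwise
    where
    pointwise : ∀ i → ite (lookup (⊥ {n}) i) (w i) ≈ 0#
    pointwise i rewrite lookup-replicate i false = refl

  weight-⁅⁆ : ∀ {n} (w : Fin n → Carrier) e → weight w ⁅ e ⁆ ≈ w e
  weight-⁅⁆ {suc n} w Fin.zero    = trans (+-congˡ (weight-⊥ (λ i → w (Fin.suc i)))) (+-identityʳ _)
  weight-⁅⁆ {suc n} w (Fin.suc e) = trans (+-identityˡ _) (weight-⁅⁆ (λ i → w (Fin.suc i)) e)

  weight-cong : ∀ {n} {v w : Fin n → Carrier} → (∀ i → v i ≈ w i) → ∀ X → weight v X ≈ weight w X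
  weight-cong {n} {v} {w} v≈w X = sumFin-cong n pointwise
    where
    pointwise : ∀ i → ite (lookup X i) (v i) ≈ ite (lookup X i) (w i)
    pointwise i with lookup X i
    ... | true  = v≈w i
    ... | false = refl

  Submodular : ∀ {n} → (Subset n → Carrier) → Set ℓ₂
  Submodular f = ∀ X Y → (f (X ∩ Y) + f (X ∪ Y)) ≤ (f X + f Y)

  submodular⇒≤norm : ∀ {n} (f : Subset n → Carrier) → f ⊥ ≈ 0# → Submodular f → ∀ X → f X ≤ norm F f X
  submodular⇒≤norm {zero}  f f⊥≈0 sub [] = ≤-reflexive f⊥≈0
  submodular⇒≤norm {suc n} f f⊥≈0 sub (s ∷ X) = head-case s
    where
    open ≤-Reasoning
    f₀ : Subset n → Carrier
    f₀ Y = f (outside ∷ Y)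

    f₀≤norm : f₀ X ≤ norm F f₀ X
    f₀≤norm = submodular⇒≤norm f₀ f⊥≈0 (λ Y Z → sub (outside ∷ Y) (outside ∷ Z)) X

    head-case : ∀ s → f (s ∷ X) ≤ norm F f (s ∷ X)
    head-case outside = begin
      f (outside ∷ X)                                ≤⟨ f₀≤norm ⟩
      norm F f₀ X                                    ≈⟨ +-identityˡ _ ⟨
      norm F f (outside ∷ X)                         ∎
    head-case inside = begin
      f (inside ∷ X)                                 ≈⟨ +-identityˡ _ ⟨
      0# + f (inside ∷ X)                            ≈⟨ +-congʳ f⊥≈0 ⟨
      f (outside ∷ ⊥) + f (inside ∷ X)               ≡⟨ ≡.cong₂ (λ A B → f (outside ∷ A) + f (inside ∷ B))
                                                          (≡.sym (∩-zeroˡ X)) (≡.sym (∪-identityˡ X)) ⟩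
      f (outside ∷ (⊥ ∩ X)) + f (inside ∷ (⊥ ∪ X))   ≤⟨ sub ⁅ Fin.zero ⁆ (outside ∷ X) ⟩
      f ⁅ Fin.zero ⁆ + f₀ X                          ≤⟨ +-monoʳ-≤ _ f₀≤norm ⟩
      norm F f (inside ∷ X)                          ∎

  rankOf : ∀ {n} → (Subset n → Carrier) → Subset n → Carrier
  rankOf κ X = ½ * (κ X + norm F κ X)

  module _ {n} {κ : Subset n → Carrier} (isκ : IsConnectivityFunction F κ) where
    open IsConnectivityFunction isκ

    private
      r : Subset n → Carrier
      r = rankOf κ

      ‖_‖ : Subset n → Carrier
      ‖_‖ = norm F κ

      ‖⊥‖≈0 : ‖ ⊥ ‖ ≈ 0#
      ‖⊥‖≈0 = weight-⊥ (λ x → κ ⁅ x ⁆)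

    κ⊤≈0 : κ ⊤ ≈ 0#
    κ⊤≈0 = trans (reflexive (cong κ (≡.sym ∁⊥≡⊤))) (trans (sym (symmetric ⊥)) empty)

    ⊆⇒κ≤κ+norm[─] : ∀ {X Y} → X ⊆ Y → κ X ≤ (κ Y + ‖ Y ─ X ‖)
    ⊆⇒κ≤κ+norm[─] {X} {Y} X⊆Y = begin
      κ X                                             ≈⟨ symmetric X ⟩
      κ (∁ X)                                         ≈⟨ +-identityˡ _ ⟨
      0# + κ (∁ X)                                    ≈⟨ +-congʳ empty ⟨
      κ ⊥ + κ (∁ X)                                   ≡⟨ ≡.cong₂ (λ A B → κ A + κ B)
                                                           (≡.sym (p∩[q─p]≡⊥ (∁ Y) (∁ X)))
                                                           (≡.sym (p⊆q⇒p∪[q─p]≡q (p⊆q⇒∁p⊇∁q X⊆Y))) ⟩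
      κ (∁ Y ∩ (∁ X ─ ∁ Y)) + κ (∁ Y ∪ (∁ X ─ ∁ Y))   ≤⟨ submod (∁ Y) (∁ X ─ ∁ Y) ⟩
      κ (∁ Y) + κ (∁ X ─ ∁ Y)                         ≡⟨ cong (λ D → κ (∁ Y) + κ D) (∁p─∁q≡q─p X Y) ⟩
      κ (∁ Y) + κ (Y ─ X)                             ≈⟨ +-congʳ (symmetric Y) ⟨
      κ Y + κ (Y ─ X)                                 ≤⟨ +-monoʳ-≤ (κ Y) (submodular⇒≤norm κ empty submod (Y ─ X)) ⟩
      κ Y + ‖ Y ─ X ‖                                 ∎
      where open ≤-Reasoning

    κ+norm-monotone : ∀ {X Y} → X ⊆ Y → (κ X + ‖ X ‖) ≤ (κ Y + ‖ Y ‖)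
    κ+norm-monotone {X} {Y} X⊆Y = begin
      κ X + ‖ X ‖                                    ≤⟨ +-mono-≤ ‖ X ‖ (⊆⇒κ≤κ+norm[─] X⊆Y) ⟩
      (κ Y + ‖ Y ─ X ‖) + ‖ X ‖                      ≈⟨ +-assoc (κ Y) _ _ ⟩
      κ Y + (‖ Y ─ X ‖ + ‖ X ‖)                      ≈⟨ +-congˡ (+-comm _ _) ⟩
      κ Y + (‖ X ‖ + ‖ Y ─ X ‖)                      ≈⟨ +-congˡ (weight-∩-∪ _ X (Y ─ X)) ⟨
      κ Y + (‖ X ∩ (Y ─ X) ‖ + ‖ X ∪ (Y ─ X) ‖)      ≡⟨ ≡.cong₂ (λ A B → κ Y + (‖ A ‖ + ‖ B ‖))
                                                          (p∩[q─p]≡⊥ X Y) (p⊆q⇒p∪[q─p]≡q X⊆Y) ⟩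
      κ Y + (‖ ⊥ ‖ + ‖ Y ‖)                          ≈⟨ +-congˡ (trans (+-congʳ ‖⊥‖≈0) (+-identityˡ _)) ⟩
      κ Y + ‖ Y ‖                                    ∎
      where open ≤-Reasoning

    rankOf-⁅⁆ : ∀ e → r ⁅ e ⁆ ≈ κ ⁅ e ⁆
    rankOf-⁅⁆ e = trans (*-congˡ (+-congˡ (weight-⁅⁆ _ e))) (½*[x+x]≈x _)

    rankOf-⊤ : ∀ X → r ⊤ ≈ ½ * (‖ X ‖ + ‖ ∁ X ‖)
    rankOf-⊤ X = *-congˡ (trans (+-cong κ⊤≈0 (sym (weight-∁ _ X))) (+-identityˡ _))

    rankOf-∁ : ∀ X → r (∁ X) ≈ ½ * (κ X + ‖ ∁ X ‖)
    rankOf-∁ X = *-congˡ (+-congʳ (sym (symmetric X)))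

    connectivity-rankOf : ∀ X → connectivity F r X ≈ κ X
    connectivity-rankOf X = x≈y+z⇒x-z≈y (begin
      r X + r (∁ X)                              ≈⟨ +-congˡ (rankOf-∁ X) ⟩
      ½ * (κ X + ‖ X ‖) + ½ * (κ X + ‖ ∁ X ‖)    ≈⟨ regroup ½ (κ X) ‖ X ‖ ‖ ∁ X ‖ ⟩
      ½ * (κ X + κ X) + ½ * (‖ X ‖ + ‖ ∁ X ‖)    ≈⟨ +-cong (½*[x+x]≈x (κ X)) (sym (rankOf-⊤ X)) ⟩
      κ X + r ⊤                                  ∎)
      where
      open ≈-Reasoning
      regroup : ∀ h a p q → h * (a + p) + h * (a + q) ≈ h * (a + a) + h * (p + q)
      regroup = solve 4 (λ h a p q → (h :* (a :+ p)) :+ (h :* (a :+ q))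
                                  := (h :* (a :+ a)) :+ (h :* (p :+ q))) refl

    rankOf-selfDual : SelfDual F r
    rankOf-selfDual X = x≈y+z⇒x-z≈y (begin
      r (∁ X) + norm F r X                       ≈⟨ +-cong (rankOf-∁ X) (weight-cong rankOf-⁅⁆ X) ⟩
      ½ * (κ X + ‖ ∁ X ‖) + ‖ X ‖                ≈⟨ +-congˡ (½*[x+x]≈x ‖ X ‖) ⟨
      ½ * (κ X + ‖ ∁ X ‖) + ½ * (‖ X ‖ + ‖ X ‖)  ≈⟨ regroup ½ (κ X) ‖ X ‖ ‖ ∁ X ‖ ⟩
      ½ * (κ X + ‖ X ‖) + ½ * (‖ X ‖ + ‖ ∁ X ‖)  ≈⟨ +-congˡ (rankOf-⊤ X) ⟨
      r X + r ⊤                                  ∎)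
      where
      open ≈-Reasoning
      regroup : ∀ h a p q → h * (a + q) + h * (p + p) ≈ h * (a + p) + h * (p + q)
      regroup = solve 4 (λ h a p q → (h :* (a :+ q)) :+ (h :* (p :+ p))
                                  := (h :* (a :+ p)) :+ (h :* (p :+ q))) refl

    rankOf-compact : Compact F r
    rankOf-compact e = trans (rankOf-⁅⁆ e) (sym (connectivity-rankOf ⁅ e ⁆))

    rankOf-isPolymatroid : IsPolymatroid F r
    rankOf-isPolymatroid = record
      { empty    = trans (*-congˡ (trans (+-cong empty ‖⊥‖≈0) (+-identityˡ 0#))) (zeroʳ ½)
      ; submod   = λ X Y → begin
          r (X ∩ Y) + r (X ∪ Y)                                    ≈⟨ regroup _ _ _ _ ⟩
          ½ * ((κ (X ∩ Y) + κ (X ∪ Y)) + (‖ X ∩ Y ‖ + ‖ X ∪ Y ‖))  ≤⟨ *-monoʳ-≤-nonNeg 0≤½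
                                                                        (+-mono₂-≤ (submod X Y) (≤-reflexive (weight-∩-∪ _ X Y))) ⟩
          ½ * ((κ X + κ Y) + (‖ X ‖ + ‖ Y ‖))                      ≈⟨ regroup _ _ _ _ ⟨
          r X + r Y                                                ∎
      ; monotone = λ X Y X⊆Y → *-monoʳ-≤-nonNeg 0≤½ (κ+norm-monotone X⊆Y)
      }
      where
      open ≤-Reasoning
      regroup : ∀ a b c d → ½ * (a + b) + ½ * (c + d) ≈ ½ * ((a + c) + (b + d))
      regroup = solve 5 (λ h a b c d → (h :* (a :+ b)) :+ (h :* (c :+ d))
                                    := h :* ((a :+ c) :+ (b :+ d))) refl ½

theorem4p4 : ∀ {c ℓ₁ ℓ₂ : Level} (F : OrderedField c ℓ₁ ℓ₂) (n : ℕ)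
    (κ : Subset n → OrderedField.Carrier F) →
    IsConnectivityFunction F κ →
    ∃ λ (r : Subset n → OrderedField.Carrier F) →
    IsPolymatroid F r × Compact F r × SelfDual F r
    × (∀ X → OrderedField._≈_ F (connectivity F r X) (κ X))
theorem4p4 F n κ isκ =
  rankOf F κ , rankOf-isPolymatroid F isκ , rankOf-compact F isκ , rankOf-selfDual F isκ , connectivity-rankOf F isκ
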